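{- Let $k$ be a positive even integer and for positive even integers $\ell\le k$ let \[h^{\mathrm{hol}}(\ell,k)=\frac{1}{\pi} \frac{\Gamma(k)}{\Gamma\left(k - \frac{1}{2}\right)^2} \frac{\Gamma\left(\frac{k + \ell - 1}{2}\right)^2 \Gamma\left(\frac{k - \ell + 1}{2}\right)^2}{\Gamma\left(\frac{k + \ell}{2}\right) \Gamma\left(\frac{k - \ell}{2} + 1\right)}.\] Then for every positive even integer $\ell<k$, \[h^{\mathrm{hol}}(\ell,k) \ll \frac{1}{k - \ell} \left(\frac{k - \ell}{2(k - 1)}\right)^{\frac{k - \ell}{2}},\] with an absolute implied constant. -}

module Defs where

open import Data.Nat using (ℕ; zero; suc; _+_; _*_; _∸_; _^_; _!; _/_)
open import Data.Integer using (+_)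
open import Data.Rational using (ℚ; 0ℚ)
import Data.Rational as Q

-- n // d  is the rational number n/d (only ever used with d > 0;
-- the value for d = 0 is an irrelevant convention).
_//_ : ℕ → ℕ → ℚ
n // zero  = 0ℚ
n // suc d = (+ n) Q./ suc d

infixl 7 _//_

Γℕ : ℕ → ℕ
Γℕ n = (n ∸ 1) !

-- Γ(n + 1/2) = (2n)! / (4^n n!) · √π, hence
--   Γ(n + 1/2)^2 / π = ((2n)!)^2 / (16^n (n!)^2) = SΓnum n / SΓden n.
SΓnum : ℕ → ℕ
SΓnum n = ((2 * n) !) ^ 2

SΓden : ℕ → ℕ
SΓden n = 16 ^ n * (n !) ^ 2

-- h^hol(ℓ,k) for even ℓ ≤ k, with a = (k+ℓ)/2 - 1, b = (k-ℓ)/2, so that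
--   (k+ℓ-1)/2 = a + 1/2,  (k-ℓ+1)/2 = b + 1/2,  k - 1/2 = (k-1) + 1/2,
--   (k+ℓ)/2 = a + 1,  (k-ℓ)/2 + 1 = b + 1.
-- Then  h = (1/π) Γ(k) / (π S(k-1)) · (π S(a)) (π S(b)) / (Γ(a+1) Γ(b+1))
--         = Γ(k) S(a) S(b) / (S(k-1) a! b!),   S(n) = Γ(n+1/2)^2/π.
hhol : ℕ → ℕ → ℚ
hhol ℓ k =
  (Γℕ k * SΓnum a * SΓnum b * SΓden (k ∸ 1))
  // (SΓden a * SΓden b * SΓnum (k ∸ 1) * Γℕ ((k + ℓ) / 2) * Γℕ ((k ∸ ℓ) / 2 + 1))
  where
    a = (k + ℓ) / 2 ∸ 1
    b = (k ∸ ℓ) / 2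

bound : ℕ → ℕ → ℚ
bound ℓ k = ((k ∸ ℓ) ^ m) // ((k ∸ ℓ) * (2 * (k ∸ 1)) ^ m)
  where
    m = (k ∸ ℓ) / 2

module Submission where

-- The constant 1 works. Write k = 2K, ℓ = 2L and put a = K + L - 1, b = K - L, n = a + b = k - 1.
-- Since Γ(m + 1/2)²/π = ((2m)!)² / (16^m (m!)²), we have
-- h^hol(ℓ,k) = n!³ ((2a)!)² ((2b)!)² / (a!³ b!³ ((2n)!)²), and the bound is (2b)^b / (2b (2n)^b),
-- so the claim is an inequality between natural numbers.
-- Keeping n fixed, passing from (a + 1, b) to (a, b + 1) does not increase the ratio of h^hol to the
-- bound as long as b + 1 < a: this is a polynomial inequality combined with (1 + 1/b)^b ≥ 2.
-- Starting from b = 1, where the claim reads 2 (a + 1)² ≤ (2a + 1)², it follows for all 1 ≤ b < a.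

open import Defs
open import Data.Nat using (ℕ; _<_)
open import Data.Nat.Divisibility using (_∣_)
open import Data.Product using (∃; _,_)
open import Data.Rational using (ℚ)
open import Relation.Binary.PropositionalEquality

import Data.Integer as ℤ
import Data.Integer.Properties as ℤₚ
import Data.Rational as ℚ
import Data.Rational.Properties as ℚₚ
import Data.Rational.Unnormalised.Base as ℚᵘ
import Data.Rational.Unnormalised.Properties as ℚᵘₚ

module _ where
  open import Data.Nat
    using (zero; suc; _+_; _*_; _^_; _∸_; _/_; _!; _≤_; z<s; NonZero; >-nonZero)
  open import Data.Nat.Properties
  open import Data.Nat.DivMod using (m*n/n≡m)
  open import Data.Nat.Divisibility using (divides)
  open import Data.Nat.Tactic.RingSolver using (solve-∀)
  open import Algebra.Properties.CommutativeSemigroup *-commutativeSemigroup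
    using (x∙yz≈y∙xz)

  bernoulli : ∀ x y j → x ^ j * (x + j * y) ≤ x * (x + y) ^ j
  bernoulli x y zero = ≤-reflexive (base x)
    where
      base : ∀ x → 1 * (x + 0) ≡ x * 1
      base = solve-∀
  bernoulli x y (suc j) = begin
    x ^ suc j * (x + suc j * y)                     ≤⟨ m≤m+n _ (j * y * y * x ^ j) ⟩
    x ^ suc j * (x + suc j * y) + j * y * y * x ^ j ≡⟨ regroup x y j (x ^ j) ⟩
    (x + y) * (x ^ j * (x + j * y))                 ≤⟨ *-monoʳ-≤ (x + y) (bernoulli x y j) ⟩
    (x + y) * (x * (x + y) ^ j)                     ≡⟨ x∙yz≈y∙xz (x + y) x _ ⟩
    x * (x + y) ^ suc j                             ∎
    where
      open ≤-Reasoning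
      regroup : ∀ x y j P → x * P * (x + suc j * y) + j * y * y * P ≡ (x + y) * (P * (x + j * y))
      regroup = solve-∀

  [1+1/m]^m≥2 : ∀ m .{{_ : NonZero m}} → 2 * (2 * m) ^ m ≤ (2 * suc m) ^ m
  [1+1/m]^m≥2 m = *-cancelˡ-≤ (2 * m) {{m*n≢0 2 m}} (begin
    2 * m * (2 * (2 * m) ^ m)      ≡⟨ regroup m ((2 * m) ^ m) ⟩
    (2 * m) ^ m * (2 * m + m * 2)  ≤⟨ bernoulli (2 * m) 2 m ⟩
    2 * m * (2 * m + 2) ^ m        ≡⟨ cong (λ x → 2 * m * x ^ m) 2m+2≡2[1+m] ⟩
    2 * m * (2 * suc m) ^ m        ∎)
    where
      open ≤-Reasoning
      regroup : ∀ m P → 2 * m * (2 * P) ≡ P * (2 * m + m * 2)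
      regroup = solve-∀
      2m+2≡2[1+m] : 2 * m + 2 ≡ 2 * suc m
      2m+2≡2[1+m] = trans (+-comm (2 * m) 2) (sym (*-suc 2 m))

  2*m/2≡m : ∀ m → 2 * m / 2 ≡ m
  2*m/2≡m m = trans (cong (_/ 2) (*-comm 2 m)) (m*n/n≡m m 2)

  *≤*⇒//≤// : ∀ {x y p q} .{{_ : NonZero q}} → x * q ≤ p * y → x // y ℚ.≤ p // q
  *≤*⇒//≤// {y = zero} {p} {suc q} _ =
    ℚₚ.nonNegative⁻¹ (p // suc q) {{ℚₚ.normalize-nonNeg p (suc q)}}
  *≤*⇒//≤// {x} {suc y} {p} {suc q} xq≤py = ℚₚ.toℚᵘ-cancel-≤
    (ℚᵘₚ.≤-respʳ-≃ (ℚᵘₚ.≃-sym (ℚₚ.toℚᵘ-fromℚᵘ (ℚᵘ.mkℚᵘ (ℤ.+ p) q)))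
      (ℚᵘₚ.≤-respˡ-≃ (ℚᵘₚ.≃-sym (ℚₚ.toℚᵘ-fromℚᵘ (ℚᵘ.mkℚᵘ (ℤ.+ x) y)))
        (ℚᵘ.*≤* (subst₂ ℤ._≤_ (ℤₚ.pos-* x (suc q)) (ℤₚ.pos-* p (suc y)) (ℤ.+≤+ xq≤py)))))

  fac2 : ℕ → ℕ
  fac2 zero    = 1
  fac2 (suc m) = (2 + 2 * m) * (1 + 2 * m) * fac2 m

  fac2≡[2m]! : ∀ m → fac2 m ≡ (2 * m) !
  fac2≡[2m]! zero    = refl
  fac2≡[2m]! (suc m) = begin
    (2 + 2 * m) * (1 + 2 * m) * fac2 m    ≡⟨ *-assoc (2 + 2 * m) (1 + 2 * m) (fac2 m) ⟩
    (2 + 2 * m) * ((1 + 2 * m) * fac2 m)  ≡⟨ cong (λ x → (2 + 2 * m) * ((1 + 2 * m) * x)) (fac2≡[2m]! m) ⟩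
    (2 + 2 * m) !                         ≡⟨ cong _! (*-suc 2 m) ⟨
    (2 * suc m) !                         ∎
    where open ≡-Reasoning

  2*[1+a]²≤[1+2a]² : ∀ a .{{_ : NonZero a}} → 2 * ((1 + a) * (1 + a)) ≤ (1 + 2 * a) * (1 + 2 * a)
  2*[1+a]²≤[1+2a]² (suc c) = ≤-trans (m≤m+n _ _) (≤-reflexive (gap c))
    where
      gap : ∀ c → 2 * ((1 + suc c) * (1 + suc c)) + (1 + 4 * c + 2 * c * c)
                    ≡ (1 + 2 * suc c) * (1 + 2 * suc c)
      gap = solve-∀

  -- The difference of the two sides is a polynomial in s = b - 1 and t = a - b - 2 with
  -- nonnegative coefficients.
  shift-polynomial : ∀ a b .{{_ : NonZero b}} → suc b < a →
    (1 + a) * ((1 + 2 * b) * (1 + 2 * b)) * (b + suc a) ≤ b * (1 + b) * ((1 + 2 * a) * (1 + 2 * a)) * 2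
  shift-polynomial a (suc s) b<a with m≤n⇒∃[o]m+o≡n b<a
  ... | t , refl = ≤-trans (m≤m+n _ _) (≤-reflexive (difference s t))
    where
      difference : ∀ s t → let a = 3 + s + t ; b = 1 + s in
        (1 + a) * ((1 + 2 * b) * (1 + 2 * b)) * (b + suc a)
          + (16 + 31 * t + 7 * t * t + 49 * s + 65 * s * t + 12 * s * t * t
             + 28 * s * s + 32 * s * s * t + 4 * s * s * t * t + 4 * s * s * s + 4 * s * s * s * t)
          ≡ b * (1 + b) * ((1 + 2 * a) * (1 + 2 * a)) * 2
      difference = solve-∀

  shift-ratio : ∀ a b .{{_ : NonZero b}} → suc b < a →
    let α = (2 + 2 * a) * (1 + 2 * a) ; β = (2 + 2 * b) * (1 + 2 * b) in
    (1 + a) * (1 + a) * (1 + a) * (2 * b) ^ b * (β * β * (1 + b) * (2 * (b + suc a)))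
      ≤ (1 + b) * (1 + b) * (1 + b) * (2 * suc b) ^ suc b * (α * α * b)
  shift-ratio a b b<a = begin
    (1 + a) * (1 + a) * (1 + a) * Q * (β * β * (1 + b) * (2 * n))
      ≡⟨ regroupˡ a b n Q ⟩
    c * ((1 + a) * ((1 + 2 * b) * (1 + 2 * b)) * n * Q)
      ≤⟨ *-monoʳ-≤ c (*-monoˡ-≤ Q (shift-polynomial a b b<a)) ⟩
    c * (d * 2 * Q)
      ≡⟨ cong (c *_) (*-assoc d 2 Q) ⟩
    c * (d * (2 * Q))
      ≤⟨ *-monoʳ-≤ c (*-monoʳ-≤ d ([1+1/m]^m≥2 b)) ⟩
    c * (d * R)
      ≡⟨ regroupʳ a b R ⟩
    (1 + b) * (1 + b) * (1 + b) * (2 * suc b * R) * (α * α * b)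
      ∎
    where
      open ≤-Reasoning
      α = (2 + 2 * a) * (1 + 2 * a)
      β = (2 + 2 * b) * (1 + 2 * b)
      n = b + suc a
      Q = (2 * b) ^ b
      R = (2 * suc b) ^ b
      c = 8 * ((1 + a) * (1 + a)) * ((1 + b) * (1 + b) * (1 + b))
      d = b * (1 + b) * ((1 + 2 * a) * (1 + 2 * a))
      regroupˡ : ∀ a b n Q →
        (1 + a) * (1 + a) * (1 + a) * Q
          * ((2 + 2 * b) * (1 + 2 * b) * ((2 + 2 * b) * (1 + 2 * b)) * (1 + b) * (2 * n))
          ≡ 8 * ((1 + a) * (1 + a)) * ((1 + b) * (1 + b) * (1 + b))
              * ((1 + a) * ((1 + 2 * b) * (1 + 2 * b)) * n * Q)
      regroupˡ = solve-∀
      regroupʳ : ∀ a b R →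
        8 * ((1 + a) * (1 + a)) * ((1 + b) * (1 + b) * (1 + b))
          * (b * (1 + b) * ((1 + 2 * a) * (1 + 2 * a)) * R)
          ≡ (1 + b) * (1 + b) * (1 + b) * (2 * suc b * R)
              * ((2 + 2 * a) * (1 + 2 * a) * ((2 + 2 * a) * (1 + 2 * a)) * b)
      regroupʳ = solve-∀

  -- h^hol(ℓ,k) and the bound, both multiplied by a!³ b!³ ((2n)!)² 2b (2n)^b, where n = a + b.
  scaledHhol : ℕ → ℕ → ℕ → ℕ
  scaledHhol n a b = n ! * n ! * n ! * (fac2 a * fac2 a) * (fac2 b * fac2 b) * (2 * b * (2 * n) ^ b)

  scaledBound : ℕ → ℕ → ℕ → ℕ
  scaledBound n a b = fac2 n * fac2 n * (a ! * a ! * a !) * (b ! * b ! * b !) * (2 * b) ^ b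

  scaled-base : ∀ a .{{_ : NonZero a}} → scaledHhol (suc a) a 1 ≤ scaledBound (suc a) a 1
  scaled-base a = begin
    scaledHhol (suc a) a 1           ≡⟨ expandʰ a (a !) (fac2 a) ⟩
    c * (2 * ((1 + a) * (1 + a)))    ≤⟨ *-monoʳ-≤ c (2*[1+a]²≤[1+2a]² a) ⟩
    c * ((1 + 2 * a) * (1 + 2 * a))  ≡⟨ expandᵇ a (a !) (fac2 a) ⟩
    scaledBound (suc a) a 1          ∎
    where
      open ≤-Reasoning
      c = 8 * ((1 + a) * (1 + a)) * (a ! * a ! * a !) * (fac2 a * fac2 a)
      expandʰ : ∀ a F A →
        suc a * F * (suc a * F) * (suc a * F) * (A * A) * (2 * 2) * (2 * 1 * (2 * suc a * 1))
          ≡ 8 * ((1 + a) * (1 + a)) * (F * F * F) * (A * A) * (2 * ((1 + a) * (1 + a)))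
      expandʰ = solve-∀
      expandᵇ : ∀ a F A →
        8 * ((1 + a) * (1 + a)) * (F * F * F) * (A * A) * ((1 + 2 * a) * (1 + 2 * a))
          ≡ (2 + 2 * a) * (1 + 2 * a) * A * ((2 + 2 * a) * (1 + 2 * a) * A) * (F * F * F) * 1 * 2
      expandᵇ = solve-∀

  scaled-shift : ∀ a b .{{_ : NonZero b}} → suc b < a → let n = b + suc a in
    scaledHhol n (suc a) b ≤ scaledBound n (suc a) b →
    scaledHhol n a (suc b) ≤ scaledBound n a (suc b)
  scaled-shift a b b<a ih = *-cancelʳ-≤ _ _ u {{m*n≢0 (α * α) b}} (begin
    scaledHhol n a (suc b) * u                       ≡⟨ exchange (n !) (fac2 a) (fac2 b) P α β b n ⟩
    scaledHhol n (suc a) b * v                       ≤⟨ *-monoˡ-≤ v ih ⟩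
    scaledBound n (suc a) b * v                      ≡⟨ factorˡ M (a !) (b !) Q v a ⟩
    m * ((1 + a) * (1 + a) * (1 + a) * Q * v)        ≤⟨ *-monoʳ-≤ m (shift-ratio a b b<a) ⟩
    m * ((1 + b) * (1 + b) * (1 + b) * S * u)        ≡⟨ factorʳ M (a !) (b !) S u b ⟨
    scaledBound n a (suc b) * u                      ∎)
    where
      open ≤-Reasoning
      n = b + suc a
      α = (2 + 2 * a) * (1 + 2 * a)
      β = (2 + 2 * b) * (1 + 2 * b)
      u = α * α * b
      v = β * β * (1 + b) * (2 * n)
      P = (2 * n) ^ b
      Q = (2 * b) ^ b
      S = (2 * suc b) ^ suc b
      M = fac2 n
      m = M * M * (a ! * a ! * a !) * (b ! * b ! * b !)
      exchange : ∀ N A B P α β b n →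
        N * N * N * (A * A) * (β * B * (β * B)) * (2 * suc b * (2 * n * P)) * (α * α * b)
          ≡ N * N * N * (α * A * (α * A)) * (B * B) * (2 * b * P) * (β * β * (1 + b) * (2 * n))
      exchange = solve-∀
      factorˡ : ∀ M F H Q v a →
        M * M * (suc a * F * (suc a * F) * (suc a * F)) * (H * H * H) * Q * v
          ≡ M * M * (F * F * F) * (H * H * H) * ((1 + a) * (1 + a) * (1 + a) * Q * v)
      factorˡ = solve-∀
      factorʳ : ∀ M F H S u b →
        M * M * (F * F * F) * (suc b * H * (suc b * H) * (suc b * H)) * S * u
          ≡ M * M * (F * F * F) * (H * H * H) * ((1 + b) * (1 + b) * (1 + b) * S * u)
      factorʳ = solve-∀

  scaledHhol≤scaledBound : ∀ a b .{{_ : NonZero b}} → b < a →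
    scaledHhol (b + a) a b ≤ scaledBound (b + a) a b
  scaledHhol≤scaledBound a 1 1<a = scaled-base a {{>-nonZero (<-trans z<s 1<a)}}
  scaledHhol≤scaledBound a (suc b@(suc _)) b+1<a =
    subst (λ n → scaledHhol n a (suc b) ≤ scaledBound n a (suc b)) (+-suc b a)
      (scaled-shift a b b+1<a (scaledHhol≤scaledBound (suc a) b (<-trans (n<1+n b) (m<n⇒m<1+n b+1<a))))

  SΓnum≡fac2² : ∀ m → SΓnum m ≡ fac2 m * fac2 m
  SΓnum≡fac2² m rewrite fac2≡[2m]! m = cong ((2 * m) ! *_) (*-identityʳ ((2 * m) !))

  SΓden≡16^m*m!² : ∀ m → SΓden m ≡ 16 ^ m * (m ! * m !)
  SΓden≡16^m*m!² m = cong (λ x → 16 ^ m * (m ! * x)) (*-identityʳ (m !))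

  hholAt : ℕ → ℕ → ℕ → ℚ
  hholAt n a b = (n ! * SΓnum a * SΓnum b * SΓden n) // (SΓden a * SΓden b * SΓnum n * a ! * b !)

  boundAt : ℕ → ℕ → ℚ
  boundAt n b = (2 * b) ^ b // (2 * b * (2 * n) ^ b)

  hhol≡hholAt : ∀ k ℓ {n a b} → k ∸ 1 ≡ n → (k + ℓ) / 2 ∸ 1 ≡ a → (k ∸ ℓ) / 2 ≡ b →
    hhol ℓ k ≡ hholAt n a b
  hhol≡hholAt _ _ {n} {a} {b} refl refl refl =
    cong (λ m → (n ! * SΓnum a * SΓnum b * SΓden n) // (SΓden a * SΓden b * SΓnum n * a ! * m !))
      (m+n∸n≡m b 1)

  bound≡boundAt : ∀ k ℓ {n b} → k ∸ 1 ≡ n → k ∸ ℓ ≡ 2 * b → bound ℓ k ≡ boundAt n b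
  bound≡boundAt _ _ {n} {b} refl k∸ℓ≡2b =
    cong₂ (λ d m → d ^ m // (d * (2 * n) ^ m)) k∸ℓ≡2b (trans (cong (_/ 2) k∸ℓ≡2b) (2*m/2≡m b))

  hhol-cross : ∀ n a b →
    (n ! * SΓnum a * SΓnum b * SΓden n) * (2 * b * (2 * n) ^ b) ≡ scaledHhol n a b * 16 ^ n
  hhol-cross n a b rewrite SΓnum≡fac2² a | SΓnum≡fac2² b | SΓden≡16^m*m!² n =
    regroup (n !) (fac2 a) (fac2 b) (16 ^ n) ((2 * n) ^ b) b
    where
      regroup : ∀ N A B T P b →
        N * (A * A) * (B * B) * (T * (N * N)) * (2 * b * P)
          ≡ N * N * N * (A * A) * (B * B) * (2 * b * P) * T
      regroup = solve-∀

  bound-cross : ∀ a b →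
    scaledBound (b + a) a b * 16 ^ (b + a) ≡ (2 * b) ^ b * (SΓden a * SΓden b * SΓnum (b + a) * a ! * b !)
  bound-cross a b
    rewrite ^-distribˡ-+-* 16 b a | SΓden≡16^m*m!² a | SΓden≡16^m*m!² b | SΓnum≡fac2² (b + a) =
    regroup (fac2 (b + a)) (a !) (b !) ((2 * b) ^ b) (16 ^ b) (16 ^ a)
    where
      regroup : ∀ M F H Q Tb Ta →
        M * M * (F * F * F) * (H * H * H) * Q * (Tb * Ta)
          ≡ Q * (Ta * (F * F) * (Tb * (H * H)) * (M * M) * F * H)
      regroup = solve-∀

  hholAt≤boundAt : ∀ a b .{{_ : NonZero b}} → b < a → hholAt (b + a) a b ℚ.≤ boundAt (b + a) b
  hholAt≤boundAt a b@(suc _) b<a = *≤*⇒//≤// {{q≢0}} (begin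
    (n ! * SΓnum a * SΓnum b * SΓden n) * (2 * b * (2 * n) ^ b)
      ≡⟨ hhol-cross n a b ⟩
    scaledHhol n a b * 16 ^ n
      ≤⟨ *-monoˡ-≤ (16 ^ n) (scaledHhol≤scaledBound a b b<a) ⟩
    scaledBound n a b * 16 ^ n
      ≡⟨ bound-cross a b ⟩
    (2 * b) ^ b * (SΓden a * SΓden b * SΓnum n * a ! * b !)
      ∎)
    where
      open ≤-Reasoning
      n = b + a
      q≢0 : NonZero (2 * b * (2 * n) ^ b)
      q≢0 = m*n≢0 (2 * b) ((2 * n) ^ b) {{m*n≢0 2 b}} {{m^n≢0 (2 * n) b}}

  hhol≤bound : ∀ k ℓ → 2 ∣ k → 2 ∣ ℓ → 0 < ℓ → ℓ < k → hhol ℓ k ℚ.≤ bound ℓ k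
  hhol≤bound .(K * 2) .(0 * 2) (divides K refl) (divides zero refl) () _
  hhol≤bound .(K * 2) .(suc u * 2) (divides K refl) (divides (suc u) refl) _ ℓ<k
    with m≤n⇒∃[o]m+o≡n (*-cancelʳ-< 2 (suc u) K ℓ<k)
  ... | c , refl = subst₂ ℚ._≤_
    (sym (hhol≡hholAt k ℓ k∸1≡b+a [k+ℓ]/2∸1≡a (trans (cong (_/ 2) k∸ℓ≡2b) (2*m/2≡m b))))
    (sym (bound≡boundAt k ℓ {b = b} k∸1≡b+a k∸ℓ≡2b))
    (hholAt≤boundAt a b (m<m+n b z<s))
    where
      b = suc c
      a = b + suc (u + u)
      k = (2 + u + c) * 2
      ℓ = suc u * 2
      k∸1≡b+a : k ∸ 1 ≡ b + a
      k∸1≡b+a = cong (_∸ 1) (identity u c)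
        where
          identity : ∀ u c → (2 + u + c) * 2 ≡ suc (suc c + (suc c + suc (u + u)))
          identity = solve-∀
      [k+ℓ]/2∸1≡a : (k + ℓ) / 2 ∸ 1 ≡ a
      [k+ℓ]/2∸1≡a = trans (cong (λ m → m / 2 ∸ 1) (identity u c)) (cong (_∸ 1) (m*n/n≡m (suc a) 2))
        where
          identity : ∀ u c → (2 + u + c) * 2 + suc u * 2 ≡ suc (suc c + suc (u + u)) * 2
          identity = solve-∀
      k∸ℓ≡2b : k ∸ ℓ ≡ 2 * b
      k∸ℓ≡2b = trans (cong (_∸ ℓ) (identity u c)) (m+n∸m≡n ℓ (2 * b))
        where
          identity : ∀ u c → (2 + u + c) * 2 ≡ suc u * 2 + 2 * suc c
          identity = solve-∀

open import Data.Rational using (ℚ; _≤_; _*_)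

lemma3p1 : ∃ λ (C : ℚ) → ∀ (k ℓ : ℕ) → 2 ∣ k → 2 ∣ ℓ → 0 < ℓ → ℓ < k →
               hhol ℓ k ≤ C * bound ℓ k
lemma3p1 = ℚ.1ℚ , λ k ℓ 2∣k 2∣ℓ 0<ℓ ℓ<k →
  subst (hhol ℓ k ≤_) (sym (ℚₚ.*-identityˡ (bound ℓ k))) (hhol≤bound k ℓ 2∣k 2∣ℓ 0<ℓ ℓ<k)
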